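{- Let $\Gamma,\Delta$ be finite sequences of formulae and $A,B,C$ formulae, and let $\Pi_{\Gamma,A\to B,\Delta}$ be some permutation of the sequence $\Gamma,A\to B,\Delta$. Suppose $\Pi_{\Gamma,A\to B,\Delta}\vdash C$ is a proper sequent derivable in $\mathcal{S}$ and the sequence $\Gamma,A$ is prime to the sequence $B,\Delta,C$. Then $\Gamma\vdash A$ and $B,\Delta\vdash C$ are derivable in $\mathcal{S}$.
   Context: System $\mathcal{S}$: formulae are built from an infinite set of propositional letters and a constant $I$ using binary connectives $\otimes$ and $\to$. Sequents are $\Gamma\vdash A$ with $\Gamma$ a finite, possibly empty, sequence of formulae and $A$ a formula. Axioms: $A\vdash A$ and $\vdash I$. Rules: weakening: from $\Gamma\vdash A$ infer $I,\Gamma\vdash A$; interchange: from $\Gamma,A,B,\Delta\vdash C$ infer $\Gamma,B,A,\Delta\vdash C$; cut: from $\Gamma\vdash A$ and $\Delta,A,\Theta\vdash B$ infer $\Delta,\Gamma,\Theta\vdash B$; $(\otimes\vdash)$: from $\Gamma,A,B,\Delta\vdash C$ infer $\Gamma,A\otimes B,\Delta\vdash C$; $(\vdash\otimes)$: from $\Gamma\vdash A$ and $\Delta\vdash B$ infer $\Gamma,\Delta\vdash A\otimes B$; $(\to\vdash)$: from $\Gamma\vdash A$ and $B,\Delta\vdash C$ infer $\Gamma,A\to B,\Delta\vdash C$; $(\vdash\to)$: from $A,\Gamma\vdash B$ infer $\Gamma\vdash A\to B$. A formula is constant if it contains no propositional letters. A formula is proper if it contains no subformula of the form $B\to C$ with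 $C$ constant and $B$ not constant; a sequence is proper if all its formulae are proper; a sequent $\Gamma\vdash A$ is proper if $\Gamma$ is proper and $A$ is proper. A sequence $\Gamma$ is prime to a sequence $\Delta$ if no propositional letter occurs both in a formula of $\Gamma$ and in a formula of $\Delta$. -}

module Defs where

open import Data.Nat using (ℕ)
open import Data.List using (List; []; _∷_; _++_; [_])
open import Data.List.Relation.Unary.All using (All)
open import Data.Empty using (⊥)
open import Data.Product using (_×_)
open import Relation.Nullary using (¬_)

infixr 6 _⊗_
infixr 5 _⇒_
data Formula : Set where
  var : ℕ → Formula
  I   : Formula
  _⊗_ : Formula → Formula → Formula
  _⇒_ : Formula → Formula → Formula

data Occurs (p : ℕ) : Formula → Set where
  here : Occurs p (var p)
  ⊗ˡ : ∀ {A B} → Occurs p A → Occurs p (A ⊗ B)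
  ⊗ʳ : ∀ {A B} → Occurs p B → Occurs p (A ⊗ B)
  ⇒ˡ : ∀ {A B} → Occurs p A → Occurs p (A ⇒ B)
  ⇒ʳ : ∀ {A B} → Occurs p B → Occurs p (A ⇒ B)

data OccursIn (p : ℕ) : List Formula → Set where
  here  : ∀ {A Γ} → Occurs p A → OccursIn p (A ∷ Γ)
  there : ∀ {A Γ} → OccursIn p Γ → OccursIn p (A ∷ Γ)

Constant : Formula → Set
Constant A = ∀ p → ¬ Occurs p A

data Proper : Formula → Set where
  var : ∀ p → Proper (var p)
  I   : Proper I
  _⊗_ : ∀ {A B} → Proper A → Proper B → Proper (A ⊗ B)
  imp : ∀ {A B} → Proper A → Proper B → ¬ (Constant B × ¬ Constant A) → Proper (A ⇒ B)

ProperSeq : List Formula → Set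
ProperSeq Γ = All Proper Γ

ProperSequent : List Formula → Formula → Set
ProperSequent Γ A = ProperSeq Γ × Proper A

PrimeTo : List Formula → List Formula → Set
PrimeTo Γ Δ = ∀ p → OccursIn p Γ → OccursIn p Δ → ⊥

infix 4 _⊢_
data _⊢_ : List Formula → Formula → Set where
  ax    : ∀ {A} → [ A ] ⊢ A
  axI   : [] ⊢ I
  weak  : ∀ {Γ A} → Γ ⊢ A → (I ∷ Γ) ⊢ A
  exch  : ∀ {Γ Δ A B C} → (Γ ++ A ∷ B ∷ Δ) ⊢ C → (Γ ++ B ∷ A ∷ Δ) ⊢ C
  cut   : ∀ {Γ Δ Θ A B} → Γ ⊢ A → (Δ ++ A ∷ Θ) ⊢ B → (Δ ++ Γ ++ Θ) ⊢ B
  ⊗L    : ∀ {Γ Δ A B C} → (Γ ++ A ∷ B ∷ Δ) ⊢ C → (Γ ++ (A ⊗ B) ∷ Δ) ⊢ C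
  ⊗R    : ∀ {Γ Δ A B} → Γ ⊢ A → Δ ⊢ B → (Γ ++ Δ) ⊢ A ⊗ B
  ⇒L    : ∀ {Γ Δ A B C} → Γ ⊢ A → (B ∷ Δ) ⊢ C → (Γ ++ (A ⇒ B) ∷ Δ) ⊢ C
  ⇒R    : ∀ {Γ A B} → (A ∷ Γ) ⊢ B → Γ ⊢ A ⇒ B

{-# OPTIONS --safe #-}
-- Cut is admissible in the cut-free calculus whose rules act on antecedents up to permutation,
-- so the derivation of Π ⊢ C may be taken cut-free.  Let P be the letters of Γ, A and Q the
-- others.  In a cut-free derivation whose succedent is over Q, every proper antecedent formula
-- over P is constant; the only delicate case is ⇒L on an implication over P, whose consequent is
-- then constant, so that by properness its antecedent is constant as well.  Induction on the
-- cut-free derivation then moves the rule introducing A ⇒ B to the bottom: every other rule acts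
-- on a formula of one side, and whatever lands in a premise whose succedent lies on the other
-- side is constant, so it can be cut away or weakened in.
module Submission where

open import Defs
open import Level using (0ℓ)
open import Data.Nat using (ℕ)
open import Data.Empty using (⊥-elim)
open import Data.List using (List; []; _∷_; _++_; [_])
import Data.List.Properties as List
open import Data.List.Relation.Unary.All as All using (All; []; _∷_)
open import Data.List.Relation.Unary.All.Properties using (++⁺; ++⁻)
open import Data.List.Relation.Unary.Any using (here)
import Data.List.Relation.Unary.Any.Properties as Any
open import Data.List.Membership.Propositional.Properties using (∈-∃++)
open import Data.List.Relation.Binary.Permutation.Propositional as ↭
  using (_↭_; ↭-refl; ↭-sym; ↭-trans; ↭-prep; ↭-swap)
open import Data.List.Relation.Binary.Permutation.Propositional.Properties
  using (↭-empty-inv; ↭-singleton-inv; ∈-resp-↭; All-resp-↭; shift; shifts; drop-∷;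
         ++⁺ˡ; ++⁺ʳ; ++-assoc; ++-comm; ++-identityʳ)
open import Data.Product as Product using (_×_; _,_; proj₁; proj₂)
open import Data.Sum using (_⊎_; inj₁; inj₂)
open import Function using (_∘_)
open import Relation.Binary.PropositionalEquality using (_≡_; refl; sym; subst)
open import Relation.Unary using (Pred; _⊆′_; _∩_; _⊥_; ∁; U; ∅)

module _ {a} {T : Set a} where

  private variable
    x y : T
    xs ys zs G G₀ G₂ R : List T

  infixr 4 _⨾_
  _⨾_ : xs ↭ ys → ys ↭ zs → xs ↭ zs
  _⨾_ = ↭-trans

  data HeadIn (x : T) (xs G R : List T) : Set a where
    inˡ : ∀ G₀ → G ↭ x ∷ G₀ → xs ↭ G₀ ++ R → HeadIn x xs G R
    inʳ : ∀ R₀ → R ↭ x ∷ R₀ → xs ↭ G ++ R₀ → HeadIn x xs G R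

  head-in : ∀ G R → x ∷ xs ↭ G ++ R → HeadIn x xs G R
  head-in {x = x} G R p with Any.++⁻ G (∈-resp-↭ p (here refl))
  ... | inj₁ x∈G with G₁ , G₂ , refl ← ∈-∃++ x∈G =
    inˡ (G₁ ++ G₂) (shift x G₁ G₂) (drop-∷ (p ⨾ ++⁺ʳ R (shift x G₁ G₂)))
  ... | inj₂ x∈R with R₁ , R₂ , refl ← ∈-∃++ x∈R =
    inʳ (R₁ ++ R₂) (shift x R₁ R₂) (drop-∷ (p ⨾ ++⁺ˡ G (shift x R₁ R₂) ⨾ shift x G (R₁ ++ R₂)))

  data Cons↭Cons : T → List T → T → List T → Set a where
    same  : xs ↭ ys → Cons↭Cons x xs x ys
    moved : ∀ zs → ys ↭ x ∷ zs → xs ↭ y ∷ zs → Cons↭Cons x xs y ys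

  cons↭cons : x ∷ xs ↭ y ∷ ys → Cons↭Cons x xs y ys
  cons↭cons {ys = ys} p with head-in [ _ ] ys p
  ... | inʳ R₀ ys↭ xs↭ = moved R₀ ys↭ xs↭
  ... | inˡ G₀ y↭ xs↭ with refl ← ↭-singleton-inv (↭-sym y↭) = same xs↭

  singleton-++-inv : ∀ xs ys → x ∷ xs ++ ys ↭ [ y ] → x ≡ y × xs ≡ [] × ys ≡ []
  singleton-++-inv [] [] p with refl ← ↭-singleton-inv p = refl , refl , refl
  singleton-++-inv [] (_ ∷ _) p with ↭-singleton-inv p
  ... | ()
  singleton-++-inv (_ ∷ _) _ p with ↭-singleton-inv p
  ... | ()

  record Refinement (xs ys us vs : List T) : Set a where
    constructor refinement
    field
      xu xv yu yv : List T
      xs↭ : xs ↭ xu ++ xv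
      ys↭ : ys ↭ yu ++ yv
      us↭ : us ↭ xu ++ yu
      vs↭ : vs ↭ xv ++ yv

  refine : ∀ xs ys us vs → xs ++ ys ↭ us ++ vs → Refinement xs ys us vs
  refine [] ys us vs p = refinement [] [] us vs ↭-refl p ↭-refl ↭-refl
  refine (x ∷ xs) ys us vs p with head-in us vs p
  ... | inˡ us₀ us↭ p′ with refinement xu xv yu yv xs↭ ys↭ us₀↭ vs↭ ← refine xs ys us₀ vs p′ =
    refinement (x ∷ xu) xv yu yv (↭-prep x xs↭) ys↭ (us↭ ⨾ ↭-prep x us₀↭) vs↭
  ... | inʳ vs₀ vs↭ p′ with refinement xu xv yu yv xs↭ ys↭ us↭ vs₀↭ ← refine xs ys us vs₀ p′ =
    refinement xu (x ∷ xv) yu yv (↭-prep x xs↭ ⨾ ↭-sym (shift x xu xv)) ys↭ us↭ (vs↭ ⨾ ↭-prep x vs₀↭)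

  data Principal (y : T) (G R : List T) : T → List T → Set a where
    principal : xs ↭ G ++ R → Principal y G R y xs
    sideˡ : ∀ G₀ → G ↭ x ∷ G₀ → xs ↭ y ∷ G₀ ++ R → Principal y G R x xs
    sideʳ : ∀ R₀ → R ↭ x ∷ R₀ → xs ↭ y ∷ G ++ R₀ → Principal y G R x xs

  principal-view : ∀ G R → x ∷ xs ↭ y ∷ G ++ R → Principal y G R x xs
  principal-view G R p with cons↭cons p
  ... | same xs↭ = principal xs↭
  ... | moved zs G++R↭ xs↭ with head-in G R (↭-sym G++R↭)
  ...   | inˡ G₀ G↭ zs↭ = sideˡ G₀ G↭ (xs↭ ⨾ ↭-prep _ zs↭)
  ...   | inʳ R₀ R↭ zs↭ = sideʳ R₀ R↭ (xs↭ ⨾ ↭-prep _ zs↭)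

  data Split (y : T) (xs ys G R : List T) : Set a where
    left  : ∀ G₁ R₁ G₂ R₂ → xs ↭ y ∷ G₁ ++ R₁ → ys ↭ G₂ ++ R₂ →
            G ↭ G₁ ++ G₂ → R ↭ R₁ ++ R₂ → Split y xs ys G R
    right : ∀ G₁ R₁ G₂ R₂ → xs ↭ G₁ ++ R₁ → ys ↭ y ∷ G₂ ++ R₂ →
            G ↭ G₁ ++ G₂ → R ↭ R₁ ++ R₂ → Split y xs ys G R

  split : ∀ xs ys G R → xs ++ ys ↭ y ∷ G ++ R → Split y xs ys G R
  split {y = y} xs ys G R p with head-in xs ys (↭-sym p)
  ... | inˡ xs₀ xs↭ G++R↭ with refinement G₁ R₁ G₂ R₂ xs₀↭ ys↭ G↭ R↭ ← refine xs₀ ys G R (↭-sym G++R↭) =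
    left G₁ R₁ G₂ R₂ (xs↭ ⨾ ↭-prep y xs₀↭) ys↭ G↭ R↭
  ... | inʳ ys₀ ys↭ G++R↭ with refinement G₁ R₁ G₂ R₂ xs↭ ys₀↭ G↭ R↭ ← refine xs ys₀ G R (↭-sym G++R↭) =
    right G₁ R₁ G₂ R₂ xs↭ (ys↭ ⨾ ↭-prep y ys₀↭) G↭ R↭

  All-split : ∀ {p} {S : Pred T p} G₁ → G ↭ G₁ ++ G₂ → All S G → All S G₁ × All S G₂
  All-split G₁ G↭ = ++⁻ G₁ ∘ All-resp-↭ G↭

  All-uncons : ∀ {p} {S : Pred T p} → G ↭ x ∷ G₀ → All S G → S x × All S G₀
  All-uncons G↭ = All.uncons ∘ All-resp-↭ G↭

private variable
  A B C C₁ C₂ D₁ D₂ : Formula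
  Γ Δ Δ′ Θ Θ′ Θ₀ Θ₁ Θ₂ Φ Ks G R : List Formula
  S P Q : Pred ℕ 0ℓ

-- Cut elimination

infix 4 _⊢ᶜᶠ_
data _⊢ᶜᶠ_ : List Formula → Formula → Set where
  ax : Θ ↭ [ A ] → Θ ⊢ᶜᶠ A
  IR : Θ ↭ [] → Θ ⊢ᶜᶠ I
  IL : Θ ↭ I ∷ Θ₀ → Θ₀ ⊢ᶜᶠ C → Θ ⊢ᶜᶠ C
  ⊗L : Θ ↭ A ⊗ B ∷ Θ₀ → A ∷ B ∷ Θ₀ ⊢ᶜᶠ C → Θ ⊢ᶜᶠ C
  ⊗R : Θ ↭ Θ₁ ++ Θ₂ → Θ₁ ⊢ᶜᶠ A → Θ₂ ⊢ᶜᶠ B → Θ ⊢ᶜᶠ A ⊗ B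
  ⇒L : Θ ↭ (A ⇒ B) ∷ Θ₁ ++ Θ₂ → Θ₁ ⊢ᶜᶠ A → B ∷ Θ₂ ⊢ᶜᶠ C → Θ ⊢ᶜᶠ C
  ⇒R : A ∷ Θ ⊢ᶜᶠ B → Θ ⊢ᶜᶠ A ⇒ B

exchange : Θ ↭ Θ′ → Θ ⊢ᶜᶠ C → Θ′ ⊢ᶜᶠ C
exchange σ (ax p)      = ax (↭-sym σ ⨾ p)
exchange σ (IR p)      = IR (↭-sym σ ⨾ p)
exchange σ (IL p d)    = IL (↭-sym σ ⨾ p) d
exchange σ (⊗L p d)    = ⊗L (↭-sym σ ⨾ p) d
exchange σ (⊗R p d e)  = ⊗R (↭-sym σ ⨾ p) d e
exchange σ (⇒L p d e)  = ⇒L (↭-sym σ ⨾ p) d e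
exchange σ (⇒R d)      = ⇒R (exchange (↭-prep _ σ) d)

data RightRule : Θ ⊢ᶜᶠ C → Set where
  by-IR : {p : Θ ↭ []} → RightRule (IR p)
  by-⊗R : {p : Θ ↭ Θ₁ ++ Θ₂} {d : Θ₁ ⊢ᶜᶠ A} {e : Θ₂ ⊢ᶜᶠ B} → RightRule (⊗R p d e)
  by-⇒R : {d : A ∷ Θ ⊢ᶜᶠ B} → RightRule (⇒R d)

-- Termination is by the cut formula, then the left derivation, then the right one.
cut-admissible : ∀ X → Γ ⊢ᶜᶠ X → Δ ⊢ᶜᶠ C → Δ ↭ X ∷ Δ′ → Γ ++ Δ′ ⊢ᶜᶠ C
cut-right-rule : ∀ X (d : Γ ⊢ᶜᶠ X) → RightRule d → Δ ⊢ᶜᶠ C → Δ ↭ X ∷ Δ′ → Γ ++ Δ′ ⊢ᶜᶠ C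

cut-admissible X (ax p) e q = exchange (q ⨾ ++⁺ʳ _ (↭-sym p)) e
cut-admissible X (IL p d) e q = IL (++⁺ʳ _ p) (cut-admissible X d e q)
cut-admissible X (⊗L p d) e q = ⊗L (++⁺ʳ _ p) (cut-admissible X d e q)
cut-admissible X (⇒L {Θ₁ = Θ₁} {Θ₂} p d₁ d₂) e q =
  ⇒L (++⁺ʳ _ p ⨾ ↭-prep _ (++-assoc Θ₁ Θ₂ _)) d₁ (cut-admissible X d₂ e q)
cut-admissible X d@(IR _)     e q = cut-right-rule X d by-IR e q
cut-admissible X d@(⊗R _ _ _) e q = cut-right-rule X d by-⊗R e q
cut-admissible X d@(⇒R _)     e q = cut-right-rule X d by-⇒R e q

cut-right-rule X d r (ax p) q with refl ← ↭-singleton-inv (↭-sym q ⨾ p) =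
  exchange (↭-sym (++-identityʳ _)) d
cut-right-rule X d r (IR p) q with ↭-empty-inv (↭-sym q ⨾ p)
... | ()
cut-right-rule {Γ = Γ} X d r (IL p e) q with cons↭cons (↭-sym q ⨾ p)
... | same Δ′↭ with by-IR {p = Γ↭} ← r = exchange (↭-sym Δ′↭ ⨾ ↭-sym (++⁺ʳ _ Γ↭)) e
... | moved zs Θ₀↭ Δ′↭ = IL (++⁺ˡ Γ Δ′↭ ⨾ shift I Γ zs) (cut-admissible X d e Θ₀↭)
cut-right-rule {Γ = Γ} X d r (⊗L {A = A} {B} p e) q with cons↭cons (↭-sym q ⨾ p)
... | same {xs = Δ′} {ys = Θ₀} Δ′↭ with by-⊗R {Θ₁ = Γ₁} {Θ₂ = Γ₂} {p = Γ↭} {d = d₁} {e = d₂} ← r =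
  exchange (shifts Γ₂ Γ₁ ⨾ ↭-sym (++-assoc Γ₁ Γ₂ Θ₀) ⨾ ++⁺ʳ Θ₀ (↭-sym Γ↭) ⨾ ++⁺ˡ Γ (↭-sym Δ′↭))
    (cut-admissible B d₂ (cut-admissible A d₁ e ↭-refl) (shift B Γ₁ Θ₀))
... | moved zs Θ₀↭ Δ′↭ =
  ⊗L (++⁺ˡ Γ Δ′↭ ⨾ shift _ Γ zs)
     (exchange (shifts Γ (A ∷ B ∷ []))
       (cut-admissible X d e (↭-prep A (↭-prep B Θ₀↭) ⨾ shifts (A ∷ B ∷ []) [ X ])))
cut-right-rule {Γ = Γ} X d r (⊗R {Θ₁ = Δ₁} {Δ₂} p e₁ e₂) q with head-in Δ₁ Δ₂ (↭-sym q ⨾ p)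
... | inˡ G₀ Δ₁↭ Δ′↭ = ⊗R (++⁺ˡ Γ Δ′↭ ⨾ ↭-sym (++-assoc Γ G₀ Δ₂)) (cut-admissible X d e₁ Δ₁↭) e₂
... | inʳ R₀ Δ₂↭ Δ′↭ = ⊗R (++⁺ˡ Γ Δ′↭ ⨾ shifts Γ Δ₁) e₁ (cut-admissible X d e₂ Δ₂↭)
cut-right-rule {Γ = Γ} X d r (⇒L {A = A} {B} {Θ₁ = Δ₁} {Δ₂} p e₁ e₂) q
  with principal-view Δ₁ Δ₂ (↭-sym q ⨾ p)
... | principal Δ′↭ with by-⇒R {d = d₀} ← r =
  exchange (++-assoc Δ₁ Γ Δ₂ ⨾ shifts Δ₁ Γ ⨾ ++⁺ˡ Γ (↭-sym Δ′↭))
    (cut-admissible B (cut-admissible A e₁ d₀ ↭-refl) e₂ ↭-refl)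
... | sideˡ G₀ Δ₁↭ Δ′↭ =
  ⇒L (++⁺ˡ Γ Δ′↭ ⨾ shift _ Γ (G₀ ++ Δ₂) ⨾ ↭-prep _ (↭-sym (++-assoc Γ G₀ Δ₂)))
     (cut-admissible X d e₁ Δ₁↭) e₂
... | sideʳ R₀ Δ₂↭ Δ′↭ =
  ⇒L (++⁺ˡ Γ Δ′↭ ⨾ shift _ Γ (Δ₁ ++ R₀) ⨾ ↭-prep _ (shifts Γ Δ₁)) e₁
     (exchange (shift B Γ R₀) (cut-admissible X d e₂ (↭-prep B Δ₂↭ ⨾ ↭-swap B X ↭-refl)))
cut-right-rule {Γ = Γ} X d r (⇒R {A = A} e) q =
  ⇒R (exchange (shift A Γ _) (cut-admissible X d e (↭-prep A q ⨾ ↭-swap A X ↭-refl)))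

cut-elimination : Γ ⊢ C → Γ ⊢ᶜᶠ C
cut-elimination ax = ax ↭-refl
cut-elimination axI = IR ↭-refl
cut-elimination (weak d) = IL ↭-refl (cut-elimination d)
cut-elimination (exch {Γ} {A = A} {B} d) = exchange (++⁺ˡ Γ (↭-swap A B ↭-refl)) (cut-elimination d)
cut-elimination (cut {Γ} {Δ} {Θ} {A} d e) =
  exchange (shifts Γ Δ) (cut-admissible A (cut-elimination d) (cut-elimination e) (shift A Δ Θ))
cut-elimination (⊗L {Γ} {Δ} {A} {B} d) =
  ⊗L (shift _ Γ Δ) (exchange (shifts Γ (A ∷ B ∷ [])) (cut-elimination d))
cut-elimination (⊗R d e) = ⊗R ↭-refl (cut-elimination d) (cut-elimination e)
cut-elimination (⇒L {Γ} {Δ} d e) = ⇒L (shift _ Γ Δ) (cut-elimination d) (cut-elimination e)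
cut-elimination (⇒R d) = ⇒R (cut-elimination d)

⊢-exchange-after : ∀ Φ → Θ ↭ Θ′ → Φ ++ Θ ⊢ C → Φ ++ Θ′ ⊢ C
⊢-exchange-after Φ ↭.refl d = d
⊢-exchange-after Φ (↭.prep x σ) d =
  subst (_⊢ _) (List.++-assoc Φ [ x ] _)
    (⊢-exchange-after (Φ ++ [ x ]) σ (subst (_⊢ _) (sym (List.++-assoc Φ [ x ] _)) d))
⊢-exchange-after Φ (↭.swap x y σ) d =
  subst (_⊢ _) (List.++-assoc Φ (y ∷ x ∷ []) _)
    (⊢-exchange-after (Φ ++ y ∷ x ∷ []) σ
      (subst (_⊢ _) (sym (List.++-assoc Φ (y ∷ x ∷ []) _)) (exch {Φ} d)))
⊢-exchange-after Φ (↭.trans σ τ) d = ⊢-exchange-after Φ τ (⊢-exchange-after Φ σ d)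

⊢-exchange : Θ ↭ Θ′ → Θ ⊢ C → Θ′ ⊢ C
⊢-exchange = ⊢-exchange-after []

⊢ᶜᶠ⇒⊢ : Θ ⊢ᶜᶠ C → Θ ⊢ C
⊢ᶜᶠ⇒⊢ (ax p) = ⊢-exchange (↭-sym p) ax
⊢ᶜᶠ⇒⊢ (IR p) = ⊢-exchange (↭-sym p) axI
⊢ᶜᶠ⇒⊢ (IL p d) = ⊢-exchange (↭-sym p) (weak (⊢ᶜᶠ⇒⊢ d))
⊢ᶜᶠ⇒⊢ (⊗L p d) = ⊢-exchange (↭-sym p) (⊗L {[]} (⊢ᶜᶠ⇒⊢ d))
⊢ᶜᶠ⇒⊢ (⊗R p d e) = ⊢-exchange (↭-sym p) (⊗R (⊢ᶜᶠ⇒⊢ d) (⊢ᶜᶠ⇒⊢ e))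
⊢ᶜᶠ⇒⊢ (⇒L {Θ₁ = Θ₁} {Θ₂} p d e) = ⊢-exchange (shift _ Θ₁ Θ₂ ⨾ ↭-sym p) (⇒L (⊢ᶜᶠ⇒⊢ d) (⊢ᶜᶠ⇒⊢ e))
⊢ᶜᶠ⇒⊢ (⇒R d) = ⇒R (⊢ᶜᶠ⇒⊢ d)

-- Constant formulas

letters : Formula → Pred ℕ 0ℓ
letters A p = Occurs p A

⊗-⊆′ : letters A ⊆′ S → letters B ⊆′ S → letters (A ⊗ B) ⊆′ S
⊗-⊆′ A⊆S B⊆S p (⊗ˡ o) = A⊆S p o
⊗-⊆′ A⊆S B⊆S p (⊗ʳ o) = B⊆S p o

⇒-⊆′ : letters A ⊆′ S → letters B ⊆′ S → letters (A ⇒ B) ⊆′ S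
⇒-⊆′ A⊆S B⊆S p (⇒ˡ o) = A⊆S p o
⇒-⊆′ A⊆S B⊆S p (⇒ʳ o) = B⊆S p o

⊗-⊆′⁻ : letters (A ⊗ B) ⊆′ S → letters A ⊆′ S × letters B ⊆′ S
⊗-⊆′⁻ A⊗B⊆S = (λ p → A⊗B⊆S p ∘ ⊗ˡ) , (λ p → A⊗B⊆S p ∘ ⊗ʳ)

⇒-⊆′⁻ : letters (A ⇒ B) ⊆′ S → letters A ⊆′ S × letters B ⊆′ S
⇒-⊆′⁻ A⇒B⊆S = (λ p → A⇒B⊆S p ∘ ⇒ˡ) , (λ p → A⇒B⊆S p ∘ ⇒ʳ)

constant-⊆′ : Constant A → letters A ⊆′ S
constant-⊆′ A-constant p o = ⊥-elim (A-constant p o)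

common-constant : P ⊥ Q → letters A ⊆′ P → letters A ⊆′ Q → Constant A
common-constant P⊥Q A⊆P A⊆Q p o = P⊥Q (A⊆P p o , A⊆Q p o)

proper-⇒-constant : Proper (A ⇒ B) → Constant B → Constant A
proper-⇒-constant (imp _ _ proper) B-constant p o = proper (B-constant , λ A-constant → A-constant p o)

proper-⇒⁻ : Proper (A ⇒ B) → Proper A × Proper B
proper-⇒⁻ (imp A-proper B-proper _) = A-proper , B-proper

ProperOver : Pred ℕ 0ℓ → Pred Formula 0ℓ
ProperOver S = Proper ∩ λ A → letters A ⊆′ S

ProperOver-⊗⁻ : ProperOver S (A ⊗ B) → ProperOver S A × ProperOver S B
ProperOver-⊗⁻ (A-proper ⊗ B-proper , A⊗B⊆S) = Product.zip _,_ _,_ (A-proper , B-proper) (⊗-⊆′⁻ A⊗B⊆S)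

ProperOver-⇒⁻ : ProperOver S (A ⇒ B) → ProperOver S A × ProperOver S B
ProperOver-⇒⁻ (A⇒B-proper , A⇒B⊆S) =
  Product.zip _,_ _,_ (proper-⇒⁻ A⇒B-proper) (⇒-⊆′⁻ A⇒B⊆S)

constant-provable : ∀ K → Constant K → [] ⊢ᶜᶠ K
constant-weaken : ∀ K → Constant K → Θ ⊢ᶜᶠ C → K ∷ Θ ⊢ᶜᶠ C

constant-provable (var p) K-constant = ⊥-elim (K-constant p here)
constant-provable I K-constant = IR ↭-refl
constant-provable (K ⊗ L) K⊗L-constant with K-constant , L-constant ← ⊗-⊆′⁻ K⊗L-constant =
  ⊗R ↭-refl (constant-provable K K-constant) (constant-provable L L-constant)
constant-provable (K ⇒ L) K⇒L-constant with K-constant , L-constant ← ⇒-⊆′⁻ K⇒L-constant =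
  ⇒R (constant-weaken K K-constant (constant-provable L L-constant))

constant-weaken (var p) K-constant d = ⊥-elim (K-constant p here)
constant-weaken I K-constant d = IL ↭-refl d
constant-weaken (K ⊗ L) K⊗L-constant d with K-constant , L-constant ← ⊗-⊆′⁻ K⊗L-constant =
  ⊗L ↭-refl (constant-weaken K K-constant (constant-weaken L L-constant d))
constant-weaken (K ⇒ L) K⇒L-constant d with K-constant , L-constant ← ⇒-⊆′⁻ K⇒L-constant =
  ⇒L ↭-refl (constant-provable K K-constant) (constant-weaken L L-constant d)

weaken-constants : All Constant Ks → Φ ⊢ᶜᶠ C → Θ ↭ Ks ++ Φ → Θ ⊢ᶜᶠ C
weaken-constants [] d σ = exchange (↭-sym σ) d
weaken-constants (K-constant ∷ Ks-constant) d σ =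
  exchange (↭-sym σ) (constant-weaken _ K-constant (weaken-constants Ks-constant d ↭-refl))

strengthen-constants : All Constant Ks → Θ ⊢ᶜᶠ C → Θ ↭ Ks ++ Φ → Φ ⊢ᶜᶠ C
strengthen-constants [] d σ = exchange σ d
strengthen-constants (K-constant ∷ Ks-constant) d σ =
  strengthen-constants Ks-constant (cut-admissible _ (constant-provable _ K-constant) d σ) ↭-refl

module Separation (P⊥Q : P ⊥ Q) where

  Separated : Pred Formula 0ℓ
  Separated A = ProperOver P A ⊎ letters A ⊆′ Q

  separated-⊗⁻ : Separated (A ⊗ B) → Separated A × Separated B
  separated-⊗⁻ (inj₁ A⊗B-over) = Product.map inj₁ inj₁ (ProperOver-⊗⁻ A⊗B-over)
  separated-⊗⁻ (inj₂ A⊗B⊆Q) = Product.map inj₂ inj₂ (⊗-⊆′⁻ A⊗B⊆Q)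

  separated-⇒⁻ : Separated (A ⇒ B) → Separated A × Separated B
  separated-⇒⁻ (inj₁ A⇒B-over) = Product.map inj₁ inj₁ (ProperOver-⇒⁻ A⇒B-over)
  separated-⇒⁻ (inj₂ A⇒B⊆Q) = Product.map inj₂ inj₂ (⇒-⊆′⁻ A⇒B⊆Q)

  separated-⇒-⊆′ : Separated (A ⇒ B) → letters B ⊆′ Q → letters (A ⇒ B) ⊆′ Q
  separated-⇒-⊆′ (inj₂ A⇒B⊆Q) _ = A⇒B⊆Q
  separated-⇒-⊆′ (inj₁ (A⇒B-proper , A⇒B⊆P)) B⊆Q =
    let B-constant = common-constant P⊥Q (proj₂ (⇒-⊆′⁻ A⇒B⊆P)) B⊆Q
    in constant-⊆′ (⇒-⊆′ (proper-⇒-constant A⇒B-proper B-constant) B-constant)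

  antecedent-⊆′-Q : Θ ⊢ᶜᶠ C → All Separated Θ → letters C ⊆′ Q → All (λ A → letters A ⊆′ Q) Θ
  antecedent-⊆′-Q (ax p) _ C⊆Q = All-resp-↭ (↭-sym p) (C⊆Q ∷ [])
  antecedent-⊆′-Q (IR p) _ _ = All-resp-↭ (↭-sym p) []
  antecedent-⊆′-Q (IL p d) Θ-sep C⊆Q =
    All-resp-↭ (↭-sym p) ((λ _ ()) ∷ antecedent-⊆′-Q d (proj₂ (All-uncons p Θ-sep)) C⊆Q)
  antecedent-⊆′-Q (⊗L p d) Θ-sep C⊆Q
    with A⊗B-sep , Θ₀-sep ← All-uncons p Θ-sep
    with A-sep , B-sep ← separated-⊗⁻ A⊗B-sep
    with A⊆Q ∷ B⊆Q ∷ Θ₀⊆Q ← antecedent-⊆′-Q d (A-sep ∷ B-sep ∷ Θ₀-sep) C⊆Q =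
    All-resp-↭ (↭-sym p) (⊗-⊆′ A⊆Q B⊆Q ∷ Θ₀⊆Q)
  antecedent-⊆′-Q (⊗R {Θ₁ = Θ₁} p d₁ d₂) Θ-sep C⊆Q
    with Θ₁-sep , Θ₂-sep ← All-split Θ₁ p Θ-sep
    with C₁⊆Q , C₂⊆Q ← ⊗-⊆′⁻ C⊆Q =
    All-resp-↭ (↭-sym p) (++⁺ (antecedent-⊆′-Q d₁ Θ₁-sep C₁⊆Q) (antecedent-⊆′-Q d₂ Θ₂-sep C₂⊆Q))
  antecedent-⊆′-Q (⇒L {Θ₁ = Θ₁} p d₁ d₂) Θ-sep C⊆Q
    with D-sep , Θ₁₂-sep ← All-uncons p Θ-sep
    with Θ₁-sep , Θ₂-sep ← ++⁻ Θ₁ Θ₁₂-sep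
    with D₁-sep , D₂-sep ← separated-⇒⁻ D-sep
    with D₂⊆Q ∷ Θ₂⊆Q ← antecedent-⊆′-Q d₂ (D₂-sep ∷ Θ₂-sep) C⊆Q
    with D⊆Q ← separated-⇒-⊆′ D-sep D₂⊆Q =
    All-resp-↭ (↭-sym p) (D⊆Q ∷ ++⁺ (antecedent-⊆′-Q d₁ Θ₁-sep (proj₁ (⇒-⊆′⁻ D⊆Q))) Θ₂⊆Q)
  antecedent-⊆′-Q (⇒R d) Θ-sep C⊆Q with C₁⊆Q , C₂⊆Q ← ⇒-⊆′⁻ C⊆Q =
    All.tail (antecedent-⊆′-Q d (inj₂ C₁⊆Q ∷ Θ-sep) C₂⊆Q)

  separated-constant : Θ ⊢ᶜᶠ C → Θ ↭ G ++ R → All (ProperOver P) G → All (λ A → letters A ⊆′ Q) R →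
                       letters C ⊆′ Q → All Constant G
  separated-constant {G = G} d σ G-over R⊆Q C⊆Q =
    let Θ-sep = All-resp-↭ (↭-sym σ) (++⁺ (All.map inj₁ G-over) (All.map inj₂ R⊆Q))
        G⊆Q , _ = All-split G σ (antecedent-⊆′-Q d Θ-sep C⊆Q)
    in All.zipWith (λ ((_ , A⊆P) , A⊆Q) → common-constant P⊥Q A⊆P A⊆Q) (G-over , G⊆Q)

constant-succedent⇒constant-antecedent : Θ ⊢ᶜᶠ C → All Proper Θ → Constant C → All Constant Θ
constant-succedent⇒constant-antecedent d Θ-proper C-constant =
  antecedent-⊆′-Q d (All.map (λ A-proper → inj₁ (A-proper , _)) Θ-proper) C-constant
  where open Separation {P = U} {Q = ∅} (λ ())

module ⇒L-Inversion (P⊥Q : P ⊥ Q) {A B : Formula} (A⇒B-proper : Proper (A ⇒ B))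
                    (A⊆P : letters A ⊆′ P) (B⊆Q : letters B ⊆′ Q) where

  B-over : ProperOver Q B
  B-over = proj₂ (proper-⇒⁻ A⇒B-proper) , B⊆Q

  constantˡ : Θ ⊢ᶜᶠ C → Θ ↭ G ++ R → All (ProperOver P) G → All (ProperOver Q) R →
              letters C ⊆′ Q → All Constant G
  constantˡ d σ G-over R-over = Separation.separated-constant P⊥Q d σ G-over (All.map proj₂ R-over)

  constantʳ : Θ ⊢ᶜᶠ C → Θ ↭ G ++ R → All (ProperOver P) G → All (ProperOver Q) R →
              letters C ⊆′ P → All Constant R
  constantʳ {G = G} {R = R} d σ G-over R-over =
    Separation.separated-constant (λ (q , p) → P⊥Q (p , q)) d (σ ⨾ ++-comm G R)
                                  R-over (All.map proj₂ G-over)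

  ⇒L-principal : Θ₁ ⊢ᶜᶠ A → B ∷ Θ₂ ⊢ᶜᶠ C → Θ₁ ++ Θ₂ ↭ G ++ R →
                 All (ProperOver P) G → All (ProperOver Q) R → letters C ⊆′ Q →
                 G ⊢ᶜᶠ A × B ∷ R ⊢ᶜᶠ C
  ⇒L-principal {Θ₁ = Θ₁} {Θ₂ = Θ₂} {G = G} {R = R} d₁ d₂ σ G-over R-over C⊆Q
    with refinement G₁ R₁ G₂ R₂ Θ₁↭ Θ₂↭ G↭ R↭ ← refine Θ₁ Θ₂ G R σ =
    let G₁-over , G₂-over = All-split G₁ G↭ G-over
        R₁-over , R₂-over = All-split R₁ R↭ R-over
        B∷Θ₂↭ = ↭-prep B Θ₂↭ ⨾ ↭-sym (shift B G₂ R₂)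
        R₁-constant = constantʳ d₁ Θ₁↭ G₁-over R₁-over A⊆P
        G₂-constant = constantˡ d₂ B∷Θ₂↭ G₂-over (B-over ∷ R₂-over) C⊆Q
    in weaken-constants G₂-constant (strengthen-constants R₁-constant d₁ (Θ₁↭ ⨾ ++-comm G₁ R₁))
                        (G↭ ⨾ ++-comm G₁ G₂)
     , weaken-constants R₁-constant (strengthen-constants G₂-constant d₂ B∷Θ₂↭)
                        (↭-prep B R↭ ⨾ ↭-sym (shift B R₁ R₂))

  ⇒L-inv : Θ ⊢ᶜᶠ C → Θ ↭ (A ⇒ B) ∷ G ++ R → All (ProperOver P) G → All (ProperOver Q) R →
           ProperOver Q C → G ⊢ᶜᶠ A × B ∷ R ⊢ᶜᶠ C

  ⊗R-case : Θ₁ ⊢ᶜᶠ C₁ → Θ₂ ⊢ᶜᶠ C₂ → Θ₁ ++ Θ₂ ↭ (A ⇒ B) ∷ G ++ R →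
            All (ProperOver P) G → All (ProperOver Q) R → ProperOver Q (C₁ ⊗ C₂) →
            G ⊢ᶜᶠ A × B ∷ R ⊢ᶜᶠ C₁ ⊗ C₂

  ⇒L-caseˡ : Θ₁ ⊢ᶜᶠ D₁ → D₂ ∷ Θ₂ ⊢ᶜᶠ C → Θ₁ ++ Θ₂ ↭ (A ⇒ B) ∷ G ++ R → ProperOver P (D₁ ⇒ D₂) →
             All (ProperOver P) G → All (ProperOver Q) R → ProperOver Q C →
             (D₁ ⇒ D₂) ∷ G ⊢ᶜᶠ A × B ∷ R ⊢ᶜᶠ C

  ⇒L-caseʳ : Θ₁ ⊢ᶜᶠ D₁ → D₂ ∷ Θ₂ ⊢ᶜᶠ C → Θ₁ ++ Θ₂ ↭ (A ⇒ B) ∷ G ++ R → ProperOver Q (D₁ ⇒ D₂) →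
             All (ProperOver P) G → All (ProperOver Q) R → ProperOver Q C →
             G ⊢ᶜᶠ A × B ∷ (D₁ ⇒ D₂) ∷ R ⊢ᶜᶠ C

  ⇒L-inv {G = G} {R = R} (ax p) σ _ _ (_ , C⊆Q)
    with refl , refl , refl ← singleton-++-inv G R (↭-sym σ ⨾ p) =
    let A-constant = common-constant P⊥Q A⊆P (proj₁ (⇒-⊆′⁻ C⊆Q))
    in constant-provable A A-constant , ⇒R (constant-weaken A A-constant (ax ↭-refl))
  ⇒L-inv (IR p) σ _ _ _ with ↭-empty-inv (↭-sym σ ⨾ p)
  ... | ()
  ⇒L-inv (IL p d) σ G-over R-over C-over with principal-view _ _ (↭-sym p ⨾ σ)
  ... | sideˡ G₀ G↭ Θ₀↭ with t₁ , t₂ ← ⇒L-inv d Θ₀↭ (proj₂ (All-uncons G↭ G-over)) R-over C-over =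
    IL G↭ t₁ , t₂
  ... | sideʳ R₀ R↭ Θ₀↭ with t₁ , t₂ ← ⇒L-inv d Θ₀↭ G-over (proj₂ (All-uncons R↭ R-over)) C-over =
    t₁ , IL (↭-prep B R↭ ⨾ ↭-swap B I ↭-refl) t₂
  ⇒L-inv {G = G} (⊗L {A = A′} {B = B′} p d) σ G-over R-over C-over
    with principal-view _ _ (↭-sym p ⨾ σ)
  ... | sideˡ G₀ G↭ Θ₀↭ =
    let F-over , G₀-over = All-uncons G↭ G-over
        A′-over , B′-over = ProperOver-⊗⁻ F-over
        t₁ , t₂ = ⇒L-inv d (↭-prep A′ (↭-prep B′ Θ₀↭) ⨾ shifts (A′ ∷ B′ ∷ []) [ A ⇒ B ])
                         (A′-over ∷ B′-over ∷ G₀-over) R-over C-over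
    in ⊗L G↭ t₁ , t₂
  ... | sideʳ R₀ R↭ Θ₀↭ =
    let F-over , R₀-over = All-uncons R↭ R-over
        A′-over , B′-over = ProperOver-⊗⁻ F-over
        t₁ , t₂ = ⇒L-inv d (↭-prep A′ (↭-prep B′ Θ₀↭) ⨾ shifts (A′ ∷ B′ ∷ []) ((A ⇒ B) ∷ G))
                         G-over (A′-over ∷ B′-over ∷ R₀-over) C-over
    in t₁ , ⊗L (↭-prep B R↭ ⨾ ↭-swap B _ ↭-refl) (exchange (shifts [ B ] (A′ ∷ B′ ∷ [])) t₂)
  ⇒L-inv (⊗R p d₁ d₂) σ G-over R-over C-over = ⊗R-case d₁ d₂ (↭-sym p ⨾ σ) G-over R-over C-over
  ⇒L-inv {G = G} {R = R} (⇒R {A = C₁} d) σ G-over R-over C-over =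
    let C₁-over , C₂-over = ProperOver-⇒⁻ C-over
        t₁ , t₂ = ⇒L-inv d (↭-prep C₁ σ ⨾ ↭-sym (shift C₁ ((A ⇒ B) ∷ G) R))
                         G-over (C₁-over ∷ R-over) C₂-over
    in t₁ , ⇒R (exchange (↭-swap B C₁ ↭-refl) t₂)
  ⇒L-inv (⇒L p d₁ d₂) σ G-over R-over C-over with principal-view _ _ (↭-sym p ⨾ σ)
  ... | principal Θ↭ = ⇒L-principal d₁ d₂ Θ↭ G-over R-over (proj₂ C-over)
  ... | sideˡ G₀ G↭ Θ↭ =
    let D-over , G₀-over = All-uncons G↭ G-over
        t₁ , t₂ = ⇒L-caseˡ d₁ d₂ Θ↭ D-over G₀-over R-over C-over
    in exchange (↭-sym G↭) t₁ , t₂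
  ... | sideʳ R₀ R↭ Θ↭ =
    let D-over , R₀-over = All-uncons R↭ R-over
        t₁ , t₂ = ⇒L-caseʳ d₁ d₂ Θ↭ D-over G-over R₀-over C-over
    in t₁ , exchange (↭-sym (↭-prep B R↭)) t₂

  ⊗R-case {Θ₁ = Θ₁} {Θ₂ = Θ₂} {G = G} {R = R} d₁ d₂ σ G-over R-over C-over with split Θ₁ Θ₂ G R σ
  ... | left G₁ R₁ G₂ R₂ Θ₁↭ Θ₂↭ G↭ R↭ =
    let G₁-over , G₂-over = All-split G₁ G↭ G-over
        R₁-over , R₂-over = All-split R₁ R↭ R-over
        C₁-over , C₂-over = ProperOver-⊗⁻ C-over
        t₁ , t₂ = ⇒L-inv d₁ Θ₁↭ G₁-over R₁-over C₁-over
        G₂-constant = constantˡ d₂ Θ₂↭ G₂-over R₂-over (proj₂ C₂-over)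
    in weaken-constants G₂-constant t₁ (G↭ ⨾ ++-comm G₁ G₂)
     , ⊗R (↭-prep B R↭) t₂ (strengthen-constants G₂-constant d₂ Θ₂↭)
  ... | right G₁ R₁ G₂ R₂ Θ₁↭ Θ₂↭ G↭ R↭ =
    let G₁-over , G₂-over = All-split G₁ G↭ G-over
        R₁-over , R₂-over = All-split R₁ R↭ R-over
        C₁-over , C₂-over = ProperOver-⊗⁻ C-over
        t₁ , t₂ = ⇒L-inv d₂ Θ₂↭ G₂-over R₂-over C₂-over
        G₁-constant = constantˡ d₁ Θ₁↭ G₁-over R₁-over (proj₂ C₁-over)
    in weaken-constants G₁-constant t₁ G↭
     , ⊗R (↭-prep B R↭ ⨾ ↭-sym (shift B R₁ R₂)) (strengthen-constants G₁-constant d₁ Θ₁↭) t₂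

  ⇒L-caseˡ {Θ₁ = Θ₁} {D₂ = D₂} {Θ₂ = Θ₂} {G = G} {R = R} d₁ d₂ σ D-over G-over R-over C-over
    with split Θ₁ Θ₂ G R σ
  ... | right G₁ R₁ G₂ R₂ Θ₁↭ Θ₂↭ G↭ R↭ =
    let G₁-over , G₂-over = All-split G₁ G↭ G-over
        R₁-over , R₂-over = All-split R₁ R↭ R-over
        D₁-over , D₂-over = ProperOver-⇒⁻ D-over
        t₁ , t₂ = ⇒L-inv d₂ (↭-prep D₂ Θ₂↭ ⨾ ↭-swap D₂ (A ⇒ B) ↭-refl)
                         (D₂-over ∷ G₂-over) R₂-over C-over
        R₁-constant = constantʳ d₁ Θ₁↭ G₁-over R₁-over (proj₂ D₁-over)
    in ⇒L (↭-prep _ G↭) (strengthen-constants R₁-constant d₁ (Θ₁↭ ⨾ ++-comm G₁ R₁)) t₁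
     , weaken-constants R₁-constant t₂ (↭-prep B R↭ ⨾ ↭-sym (shift B R₁ R₂))
  -- The succedent D₁ of d₁ is constant, hence so is its whole antecedent, A ⇒ B included.
  ... | left G₁ R₁ G₂ R₂ Θ₁↭ Θ₂↭ G↭ R↭ =
    let G₁-over , G₂-over = All-split G₁ G↭ G-over
        R₁-over , R₂-over = All-split R₁ R↭ R-over
        D₁-over , D₂-over = ProperOver-⇒⁻ D-over
        D₂∷G₂-constant = constantˡ d₂ (↭-prep D₂ Θ₂↭) (D₂-over ∷ G₂-over) R₂-over (proj₂ C-over)
        D₂-constant , G₂-constant = All.uncons D₂∷G₂-constant
        D₁-constant = proper-⇒-constant (proj₁ D-over) D₂-constant
        Θ₁-proper = All-resp-↭ (↭-sym Θ₁↭)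
                      (A⇒B-proper ∷ ++⁺ (All.map proj₁ G₁-over) (All.map proj₁ R₁-over))
        A⇒B-constant , G₁R₁-constant =
          All-uncons Θ₁↭ (constant-succedent⇒constant-antecedent d₁ Θ₁-proper D₁-constant)
        G₁-constant , R₁-constant = ++⁻ G₁ G₁R₁-constant
        A-constant , B-constant = ⇒-⊆′⁻ A⇒B-constant
    in weaken-constants (⇒-⊆′ D₁-constant D₂-constant ∷ ++⁺ G₁-constant G₂-constant)
                        (constant-provable A A-constant) (↭-prep _ G↭ ⨾ ↭-sym (++-identityʳ _))
     , weaken-constants (B-constant ∷ R₁-constant)
                        (strengthen-constants D₂∷G₂-constant d₂ (↭-prep D₂ Θ₂↭)) (↭-prep B R↭)

  ⇒L-caseʳ {Θ₁ = Θ₁} {D₂ = D₂} {Θ₂ = Θ₂} {G = G} {R = R} d₁ d₂ σ D-over G-over R-over C-over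
    with split Θ₁ Θ₂ G R σ
  ... | right G₁ R₁ G₂ R₂ Θ₁↭ Θ₂↭ G↭ R↭ =
    let G₁-over , G₂-over = All-split G₁ G↭ G-over
        R₁-over , R₂-over = All-split R₁ R↭ R-over
        D₁-over , D₂-over = ProperOver-⇒⁻ D-over
        t₁ , t₂ = ⇒L-inv d₂ (↭-prep D₂ Θ₂↭ ⨾ ↭-sym (shift D₂ ((A ⇒ B) ∷ G₂) R₂))
                         G₂-over (D₂-over ∷ R₂-over) C-over
        G₁-constant = constantˡ d₁ Θ₁↭ G₁-over R₁-over (proj₂ D₁-over)
    in weaken-constants G₁-constant t₁ G↭
     , ⇒L (↭-swap B _ R↭ ⨾ ↭-prep _ (↭-sym (shift B R₁ R₂)))
          (strengthen-constants G₁-constant d₁ Θ₁↭) (exchange (↭-swap B D₂ ↭-refl) t₂)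
  ... | left G₁ R₁ G₂ R₂ Θ₁↭ Θ₂↭ G↭ R↭ =
    let G₁-over , G₂-over = All-split G₁ G↭ G-over
        R₁-over , R₂-over = All-split R₁ R↭ R-over
        D₁-over , D₂-over = ProperOver-⇒⁻ D-over
        t₁ , t₂ = ⇒L-inv d₁ Θ₁↭ G₁-over R₁-over D₁-over
        D₂∷Θ₂↭ = ↭-prep D₂ Θ₂↭ ⨾ ↭-sym (shift D₂ G₂ R₂)
        G₂-constant = constantˡ d₂ D₂∷Θ₂↭ G₂-over (D₂-over ∷ R₂-over) (proj₂ C-over)
    in weaken-constants G₂-constant t₁ (G↭ ⨾ ++-comm G₁ G₂)
     , ⇒L (↭-swap B _ R↭) t₂ (strengthen-constants G₂-constant d₂ D₂∷Θ₂↭)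

lettersOf : List Formula → Pred ℕ 0ℓ
lettersOf Γ p = OccursIn p Γ

All-letters-⊆′ : ∀ Γ → lettersOf Γ ⊆′ S → All (λ A → letters A ⊆′ S) Γ
All-letters-⊆′ [] _ = []
All-letters-⊆′ (A ∷ Γ) Γ⊆S = (λ p → Γ⊆S p ∘ here) ∷ All-letters-⊆′ Γ (λ p → Γ⊆S p ∘ there)

proposition3p6 : (Γ Δ : List Formula) (A B C : Formula) (Π : List Formula) →
    Π ↭ (Γ ++ (A ⇒ B) ∷ Δ) →
    ProperSequent Π C →
    Π ⊢ C →
    PrimeTo (Γ ++ [ A ]) (B ∷ Δ ++ [ C ]) →
    (Γ ⊢ A) × ((B ∷ Δ) ⊢ C)
proposition3p6 Γ Δ A B C Π Π↭ (Π-proper , C-proper) ⊢C prime =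
  let Γ-proper , A⇒B∷Δ-proper = All-split Γ Π↭ Π-proper
      A⇒B-proper , Δ-proper = All.uncons A⇒B∷Δ-proper
      Γ⊆L , A∷[]⊆L = ++⁻ Γ (All-letters-⊆′ (Γ ++ [ A ]) λ _ p∈L → p∈L)
      B⊆∉L , Δ++C⊆∉L = All.uncons (All-letters-⊆′ (B ∷ Δ ++ [ C ]) λ p p∈B∷Δ∷C p∈L →
                                      prime p p∈L p∈B∷Δ∷C)
      Δ⊆∉L , C∷[]⊆∉L = ++⁻ Δ Δ++C⊆∉L
      open ⇒L-Inversion {Q = ∁ left-letters} (λ (p∈L , p∉L) → p∉L p∈L)
                        A⇒B-proper (All.head A∷[]⊆L) B⊆∉L
      ⊢ᶜᶠA , ⊢ᶜᶠC = ⇒L-inv (cut-elimination ⊢C) (Π↭ ⨾ shift (A ⇒ B) Γ Δ)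
                           (All.zip (Γ-proper , Γ⊆L)) (All.zip (Δ-proper , Δ⊆∉L))
                           (C-proper , All.head C∷[]⊆∉L)
  in ⊢ᶜᶠ⇒⊢ ⊢ᶜᶠA , ⊢ᶜᶠ⇒⊢ ⊢ᶜᶠC
  where
  left-letters : Pred ℕ 0ℓ
  left-letters = lettersOf (Γ ++ [ A ])
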